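{- Every color graph is isomorphic to a vertex-induced subgraph of a (finite-dimensional) hypercube graph.
   Context: Let $V=\mathbb{Z}_2\times\mathbb{Z}_2$ be the Klein four-group with elements $0,1,2,3$ ($1+2+3=0$, $x+x=0$). Color graphs can be described as follows. Let $n\geq 3$ and let $P$ be a convex $n$-gon whose vertices are colored by elements of $V$ so that adjacent polygon vertices have different colors. A triangulation of $P$ (using only the vertices of $P$) is compatible with the coloring if every diagonal of the triangulation joins two differently colored vertices. The color graph of this coloring has as vertices the compatible triangulations, two being adjacent iff they differ by a single diagonal flip (removing one diagonal and inserting the other diagonal of the resulting quadrilateral). (Equivalently, in dual terms: for a color vector ${\bf c}$ of nonzero elements of $V$, the color graph has as vertices the rooted planar binary trees whose leaf edges, colored by ${\bf c}$ from left to right, extend to an edge coloring by $\{1,2,3\}$ with the three colors at each internal vertex summing to $0$, with edges given by rotations; the leaf colors are the sums of the colors of the two polygon vertices nearest each leaf.) For a finite set $S$, the hypercube $\mathcal{H}(S)$ has vertex set the power set of $S$, with $A,B$ adjacent iff the symmetric difference $A\Delta B$ is a singleton. -}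

module Defs where

open import Data.Nat using (ℕ; zero; suc; _+_; _≤_; _<_)
open import Data.Fin using (Fin; toℕ)
open import Data.Bool using (Bool; true; false)
open import Data.Vec using (Vec; lookup)
open import Data.Fin.Subset using (Subset)
open import Data.Product using (Σ; _×_; _,_; proj₁)
open import Data.Sum using (_⊎_)
open import Relation.Nullary using (¬_)
open import Relation.Binary.PropositionalEquality using (_≡_; _≢_)
open import Function.Bundles using (_⇔_)

-- The Klein four-group V = Z2 × Z2, elements 0,1,2,3 encoded as Fin 4.
-- (Only equality of colours matters for the statement.)
V : Set
V = Fin 4

-- Polygon vertices are Fin n, in cyclic order 0,1,...,n-1.
-- Proper colouring: cyclically adjacent polygon vertices get different colours.
ProperColoring : (n : ℕ) → (Fin n → V) → Set
ProperColoring n c =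
  (∀ (i j : Fin n) → suc (toℕ i) ≡ toℕ j → c i ≢ c j) ×
  (∀ (i j : Fin n) → toℕ i ≡ 0 → suc (toℕ j) ≡ n → c i ≢ c j)

-- A diagonal (i,j), stored with i < j, joining two non-adjacent vertices.
Diagonal : (n : ℕ) → Fin n → Fin n → Set
Diagonal n i j = (toℕ i + 2 ≤ toℕ j) × ¬ (toℕ i ≡ 0 × suc (toℕ j) ≡ n)

-- Two diagonals (i,j), (k,l) (i<j, k<l) of a convex polygon cross (interiors meet).
Cross : {n : ℕ} → Fin n → Fin n → Fin n → Fin n → Set
Cross i j k l =
  (toℕ i < toℕ k × toℕ k < toℕ j × toℕ j < toℕ l) ⊎
  (toℕ k < toℕ i × toℕ i < toℕ l × toℕ l < toℕ j)

-- A set of diagonals, as a Boolean n×n table (entry (i,j) for i<j).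
DSet : ℕ → Set
DSet n = Vec (Vec Bool n) n

_∋_,_ : {n : ℕ} → DSet n → Fin n → Fin n → Set
D ∋ i , j = lookup (lookup D i) j ≡ true

IsTriangulation : (n : ℕ) → DSet n → Set
IsTriangulation n D =
  (∀ i j → D ∋ i , j → Diagonal n i j) ×
  (∀ i j k l → D ∋ i , j → D ∋ k , l → ¬ Cross i j k l) ×
  (∀ i j → Diagonal n i j → ¬ (D ∋ i , j) →
     Σ (Fin n) λ k → Σ (Fin n) λ l → (D ∋ k , l) × Cross i j k l)

Compatible : (n : ℕ) → (Fin n → V) → DSet n → Set
Compatible n c D = ∀ i j → D ∋ i , j → c i ≢ c j

ColorVertex : (n : ℕ) → (Fin n → V) → Set
ColorVertex n c = Σ (DSet n) λ D → IsTriangulation n D × Compatible n c D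

Flip : (n : ℕ) → DSet n → DSet n → Set
Flip n D D' =
  Σ (Fin n) λ i → Σ (Fin n) λ j → Σ (Fin n) λ k → Σ (Fin n) λ l →
    (D ∋ i , j) × ¬ (D ∋ k , l) ×
    (∀ p q → (D' ∋ p , q) ⇔
       (((D ∋ p , q) × ¬ ((p , q) ≡ (i , j))) ⊎ ((p , q) ≡ (k , l))))

ColorAdj : (n : ℕ) (c : Fin n → V) → ColorVertex n c → ColorVertex n c → Set
ColorAdj n c T T' = Flip n (proj₁ T) (proj₁ T')

HypercubeAdj : (m : ℕ) → Subset m → Subset m → Set
HypercubeAdj m A B =
  Σ (Fin m) λ k → ∀ (x : Fin m) → (lookup A x ≢ lookup B x) ⇔ (x ≡ k)

-- Encode a
-- compatible triangulation D by its nonzero part: the diagonals of D whose two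
-- endpoints both carry a nonzero colour, as a subset of the n * n ordered
-- vertex pairs.  Three facts make this an induced embedding.
--  (1) The nonzero part determines D: a diagonal with a 0-coloured endpoint
--      that is missing from D is crossed by a nonzero diagonal of D
--      (`nonzero-crossing`), so the remaining diagonals are forced.
--  (2) A flip exchanges the diagonals of a quadrilateral whose sides are edges
--      of the triangulations, so its four corners have four distinct colours;
--      as V has four elements, exactly one of the two diagonals avoids 0 and
--      the code changes in exactly one position.
--  (3) Conversely, if the codes differ only at a diagonal (u,v) of D, then D'
--      is D with (u,v) replaced by its unique flip partner.

module Submission where

open import Defs
open import Data.Nat as ℕ using (ℕ; suc; _+_; _*_; z≤n; s≤s; s≤s⁻¹)
import Data.Nat.Properties as ℕₚ
open import Data.Fin as Fin using (Fin; toℕ; fromℕ; fromℕ<; combine; remQuot)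
open import Data.Fin.Properties
  using (_≟_; toℕ-fromℕ; toℕ-fromℕ<; ≤fromℕ; toℕ<n; any?; all?; <-cmp; ≤-reflexive; ≤-antisym; ≤∧≢⇒<;
         remQuot-combine; combine-remQuot)
open import Data.Bool using (Bool; true; false; _∧_)
import Data.Bool.Properties as Boolₚ
open import Data.Vec using (lookup; tabulate)
open import Data.Vec.Properties using (lookup∘tabulate; tabulate∘lookup; tabulate-cong)
open import Data.Fin.Subset using (Subset)
open import Data.Product using (Σ; _×_; _,_; proj₁; proj₂; uncurry)
open import Data.Product.Properties using (,-injectiveˡ; ,-injectiveʳ; ≡-dec)
open import Data.Sum using (_⊎_; inj₁; inj₂)
open import Data.Empty using (⊥-elim)
open import Relation.Nullary using (¬_; Dec; yes; no; ¬?)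
open import Relation.Nullary.Decidable using (_×-dec_; _⊎-dec_; _→-dec_; toWitness)
open import Relation.Binary.Definitions using (DecidableEquality; tri<; tri≈; tri>)
open import Relation.Binary.PropositionalEquality
  using (_≡_; _≢_; refl; sym; trans; cong; subst; cong₂; ≢-sym)
open import Function.Bundles using (_⇔_; mk⇔; Equivalence)

module _ where
  open import Data.Fin using (_≤_; _<_)

  greatest : ∀ {m} (P : Fin m → Set) → (∀ v → Dec (P v)) → ∀ {v} → P v →
             Σ (Fin m) λ w → P w × (∀ v → P v → v ≤ w)
  greatest {suc m} P P? {v} pv with any? (λ v → P? (Fin.suc v))
  ... | yes (v′ , pv′) with greatest (λ v → P (Fin.suc v)) (λ v → P? (Fin.suc v)) pv′
  ...   | w , pw , max = Fin.suc w , pw , λ { Fin.zero _ → z≤n ; (Fin.suc u) pu → s≤s (max u pu) }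
  greatest {suc m} P P? {Fin.zero} pv | no none =
    Fin.zero , pv , λ { Fin.zero _ → z≤n ; (Fin.suc u) pu → ⊥-elim (none (u , pu)) }
  greatest {suc m} P P? {Fin.suc v} pv | no none = ⊥-elim (none (v , pv))

  pin : ∀ {n} {a b : Fin n} → ¬ a < b → ¬ b < a → a ≡ b
  pin {a = a} {b} ¬a<b ¬b<a with <-cmp a b
  ... | tri< a<b _ _ = ⊥-elim (¬a<b a<b)
  ... | tri≈ _ a≡b _ = a≡b
  ... | tri> _ _ b<a = ⊥-elim (¬b<a b<a)

  data Around {n} (p q w : Fin n) : Set where
    at-or-below : w ≤ p → Around p q w
    inside      : p < w → w < q → Around p q w
    at-or-above : q ≤ w → Around p q w

  around : ∀ {n} (p q w : Fin n) → Around p q w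
  around p q w with <-cmp p w | <-cmp w q
  ... | tri< p<w _ _ | tri< w<q _ _ = inside p<w w<q
  ... | tri< _ _ _   | tri≈ _ w≡q _ = at-or-above (≤-reflexive (sym w≡q))
  ... | tri< _ _ _   | tri> _ _ q<w = at-or-above (ℕₚ.<⇒≤ q<w)
  ... | tri≈ _ p≡w _ | _            = at-or-below (≤-reflexive (sym p≡w))
  ... | tri> _ _ w<p | _            = at-or-below (ℕₚ.<⇒≤ w<p)

  _≟ₚ_ : ∀ {n} → DecidableEquality (Fin n × Fin n)
  _≟ₚ_ = ≡-dec _≟_ _≟_

  pair≢ˡ : ∀ {n} {a b c d : Fin n} → a ≢ c → (a , b) ≢ (c , d)
  pair≢ˡ a≢c e = a≢c (,-injectiveˡ e)

  pair≢ʳ : ∀ {n} {a b c d : Fin n} → b ≢ d → (a , b) ≢ (c , d)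
  pair≢ʳ b≢d e = b≢d (,-injectiveʳ e)

  <⇒≢ : ∀ {n} {a b : Fin n} → a < b → a ≢ b
  <⇒≢ a<b a≡b = ℕₚ.<⇒≢ a<b (cong toℕ a≡b)

  -- Width bound on a vertex interval; the decreasing measure of the descents below.
  Span : ∀ {n} → ℕ → Fin n → Fin n → Set
  Span f x y = toℕ y ℕ.≤ toℕ x + f

  span-full : ∀ {n} (x y : Fin n) → Span n x y
  span-full {n} x y = ℕₚ.≤-trans (ℕₚ.<⇒≤ (toℕ<n y)) (ℕₚ.m≤n+m n (toℕ x))

  span-empty : ∀ {n} {x y : Fin n} → x < y → ¬ Span 0 x y
  span-empty {x = x} x<y span = ℕₚ.<⇒≱ x<y (subst (_ ℕ.≤_) (ℕₚ.+-identityʳ (toℕ x)) span)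

  span-left : ∀ {n f} {x w y : Fin n} → w < y → Span (suc f) x y → Span f x w
  span-left {f = f} {x} {y = y} w<y span =
    s≤s⁻¹ (ℕₚ.<-≤-trans w<y (subst (toℕ y ℕ.≤_) (ℕₚ.+-suc (toℕ x) f) span))

  span-right : ∀ {n f} {x w y : Fin n} → x < w → Span (suc f) x y → Span f w y
  span-right {f = f} {x} {y = y} x<w span =
    ℕₚ.≤-trans (subst (toℕ y ℕ.≤_) (ℕₚ.+-suc (toℕ x) f) span) (ℕₚ.+-monoˡ-≤ f x<w)

  gap⇒suc< : ∀ {n} {i j : Fin n} → toℕ i + 2 ℕ.≤ toℕ j → suc (toℕ i) ℕ.< toℕ j
  gap⇒suc< {i = i} {j} = subst (ℕ._≤ toℕ j) (ℕₚ.+-comm (toℕ i) 2)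

  suc<⇒gap : ∀ {n} {i j : Fin n} → suc (toℕ i) ℕ.< toℕ j → toℕ i + 2 ℕ.≤ toℕ j
  suc<⇒gap {i = i} {j} = subst (ℕ._≤ toℕ j) (ℕₚ.+-comm 2 (toℕ i))

  nested-gap : ∀ {n} {x y p q : Fin n} → x ≤ p → p < q → q ≤ y → (p , q) ≢ (x , y) → suc (toℕ x) ℕ.< toℕ y
  nested-gap {x = x} {y} {p} {q} x≤p p<q q≤y pq≢xy =
    ℕₚ.≤∧≢⇒< (ℕₚ.≤-<-trans x≤p (ℕₚ.<-≤-trans p<q q≤y)) (λ x+1≡y → pq≢xy (squeeze x+1≡y))
    where
    squeeze : suc (toℕ x) ≡ toℕ y → (p , q) ≡ (x , y)
    squeeze e = cong₂ _,_
      (≤-antisym (s≤s⁻¹ (subst (toℕ p ℕ.<_) (sym e) (ℕₚ.<-≤-trans p<q q≤y))) x≤p)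
      (≤-antisym q≤y (subst (ℕ._≤ toℕ q) e (ℕₚ.≤-<-trans x≤p p<q)))

  between-gap : ∀ {n} {x p y : Fin n} → x < p → p < y → suc (toℕ x) ℕ.< toℕ y
  between-gap x<p p<y = ℕₚ.<-≤-trans (s≤s x<p) p<y

  table : ∀ {n} → (Fin n → Fin n → Bool) → Subset (n * n)
  table {n} F = tabulate λ k → uncurry F (remQuot {n} n k)

  lookup-table : ∀ {n} (F : Fin n → Fin n → Bool) k → lookup (table F) k ≡ uncurry F (remQuot {n} n k)
  lookup-table F k = lookup∘tabulate _ k

  lookup-table-combine : ∀ {n} (F : Fin n → Fin n → Bool) p q → lookup (table F) (combine p q) ≡ F p q
  lookup-table-combine {n} F p q = trans (lookup-table F (combine p q)) (cong (uncurry F) (remQuot-combine {n} {n} p q))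

  table-injective : ∀ {n} {F G : Fin n → Fin n → Bool} → table F ≡ table G → ∀ p q → F p q ≡ G p q
  table-injective {F = F} {G} eq p q =
    trans (sym (lookup-table-combine F p q)) (trans (cong (λ t → lookup t (combine p q)) eq) (lookup-table-combine G p q))

  DifferOnlyAt : ∀ {n} → (Fin n → Fin n → Bool) → (Fin n → Fin n → Bool) → Fin n → Fin n → Set
  DifferOnlyAt F G u v = F u v ≢ G u v × (∀ p q → (p , q) ≢ (u , v) → F p q ≡ G p q)

  differ-sym : ∀ {n} {F G : Fin n → Fin n → Bool} {u v} → DifferOnlyAt F G u v → DifferOnlyAt G F u v
  differ-sym (differ , agree) = ≢-sym differ , λ p q ne → sym (agree p q ne)

  adjacent⇔differ-once : ∀ {n} (F G : Fin n → Fin n → Bool) →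
    HypercubeAdj (n * n) (table F) (table G) ⇔ (Σ (Fin n) λ u → Σ (Fin n) λ v → DifferOnlyAt F G u v)
  adjacent⇔differ-once {n} F G = mk⇔ to from
    where
    to : HypercubeAdj (n * n) (table F) (table G) → Σ (Fin n) λ u → Σ (Fin n) λ v → DifferOnlyAt F G u v
    to (K , only-K) = proj₁ (remQuot {n} n K) , proj₂ (remQuot {n} n K) , differ , agree
      where
      differ : uncurry F (remQuot {n} n K) ≢ uncurry G (remQuot {n} n K)
      differ e = Equivalence.from (only-K K) refl (trans (lookup-table F K) (trans e (sym (lookup-table G K))))

      agree : ∀ p q → (p , q) ≢ remQuot {n} n K → F p q ≡ G p q
      agree p q ne with F p q Boolₚ.≟ G p q
      ... | yes e = e
      ... | no d = ⊥-elim (ne (trans (sym (remQuot-combine {n} {n} p q)) (cong (remQuot {n} n) at-K)))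
        where
        at-K : combine p q ≡ K
        at-K = Equivalence.to (only-K (combine p q))
                 (λ e → d (trans (sym (lookup-table-combine F p q)) (trans e (lookup-table-combine G p q))))

    from : (Σ (Fin n) λ u → Σ (Fin n) λ v → DifferOnlyAt F G u v) → HypercubeAdj (n * n) (table F) (table G)
    from (u , v , differ , agree) = combine u v , λ x → mk⇔ (only x) (at x)
      where
      only : ∀ x → lookup (table F) x ≢ lookup (table G) x → x ≡ combine u v
      only x d with remQuot {n} n x ≟ₚ (u , v)
      ... | yes e = trans (sym (combine-remQuot {n} n x)) (cong (uncurry combine) e)
      ... | no ne = ⊥-elim (d (trans (lookup-table F x)
                       (trans (agree _ _ ne) (sym (lookup-table G x)))))

      at : ∀ x → x ≡ combine u v → lookup (table F) x ≢ lookup (table G) x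
      at x refl e = differ (trans (sym (lookup-table-combine F u v)) (trans e (lookup-table-combine G u v)))

  matrix-ext : ∀ {n} {D D' : DSet n} → (∀ p q → lookup (lookup D p) q ≡ lookup (lookup D' p) q) → D ≡ D'
  matrix-ext {D = D} {D'} entries =
    trans (sym (tabulate∘lookup D))
      (trans (tabulate-cong λ p → trans (sym (tabulate∘lookup (lookup D p)))
                                    (trans (tabulate-cong (entries p)) (tabulate∘lookup (lookup D' p))))
             (tabulate∘lookup D'))

  distinct-bools : ∀ {a b : Bool} → a ≢ b → (a ≡ true × b ≡ false) ⊎ (a ≡ false × b ≡ true)
  distinct-bools {true} {true} d = ⊥-elim (d refl)
  distinct-bools {true} {false} _ = inj₁ (refl , refl)
  distinct-bools {false} {true} _ = inj₂ (refl , refl)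
  distinct-bools {false} {false} d = ⊥-elim (d refl)

  -- A polygon side, oriented like a diagonal (smaller endpoint first): two
  -- consecutive vertices, or the closing side (0, n-1).
  PolygonSide : (n : ℕ) → Fin n → Fin n → Set
  PolygonSide n i j = suc (toℕ i) ≡ toℕ j ⊎ (toℕ i ≡ 0 × suc (toℕ j) ≡ n)

  Edge : ∀ {n} → DSet n → Fin n → Fin n → Set
  Edge {n} D i j = PolygonSide n i j ⊎ D ∋ i , j

  member? : ∀ {n} (D : DSet n) (i j : Fin n) → Dec (D ∋ i , j)
  member? D i j = lookup (lookup D i) j Boolₚ.≟ true

  side? : ∀ {n} (i j : Fin n) → Dec (PolygonSide n i j)
  side? {n} i j = (suc (toℕ i) ℕₚ.≟ toℕ j) ⊎-dec ((toℕ i ℕₚ.≟ 0) ×-dec (suc (toℕ j) ℕₚ.≟ n))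

  edge? : ∀ {n} (D : DSet n) (i j : Fin n) → Dec (Edge D i j)
  edge? D i j = side? i j ⊎-dec member? D i j

  cross? : ∀ {n} (i j k l : Fin n) → Dec (Cross i j k l)
  cross? i j k l =
    ((toℕ i ℕₚ.<? toℕ k) ×-dec (toℕ k ℕₚ.<? toℕ j) ×-dec (toℕ j ℕₚ.<? toℕ l)) ⊎-dec
    ((toℕ k ℕₚ.<? toℕ i) ×-dec (toℕ i ℕₚ.<? toℕ l) ×-dec (toℕ l ℕₚ.<? toℕ j))

  cross-sym : ∀ {n} {i j k l : Fin n} → Cross i j k l → Cross k l i j
  cross-sym (inj₁ c) = inj₂ c
  cross-sym (inj₂ c) = inj₁ c

  ∋-pair : ∀ {n} {D : DSet n} {p q k l : Fin n} → (p , q) ≡ (k , l) → D ∋ p , q → D ∋ k , l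
  ∋-pair refl m = m

  diagonal⇒< : ∀ {n} {i j : Fin n} → Diagonal n i j → i < j
  diagonal⇒< (gap , _) = ℕₚ.<-trans (ℕₚ.n<1+n _) (gap⇒suc< gap)

  diagonal-not-side : ∀ {n} {i j : Fin n} → Diagonal n i j → ¬ PolygonSide n i j
  diagonal-not-side (gap , _) (inj₁ consecutive) = ℕₚ.<⇒≢ (gap⇒suc< gap) consecutive
  diagonal-not-side (_ , not-closing) (inj₂ closing) = not-closing closing

  side-uncrossed : ∀ {n} {a b i j : Fin n} → PolygonSide n i j → ¬ Cross a b i j
  side-uncrossed (inj₁ e) (inj₁ (_ , i<b , b<j)) = ℕₚ.<⇒≱ i<b (s≤s⁻¹ (subst (_ ℕ.<_) (sym e) b<j))
  side-uncrossed (inj₁ e) (inj₂ (i<a , a<j , _)) = ℕₚ.<⇒≱ i<a (s≤s⁻¹ (subst (_ ℕ.<_) (sym e) a<j))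
  side-uncrossed (inj₂ (i≡0 , _)) (inj₁ (a<i , _)) = ℕₚ.n≮0 (subst (_ ℕ.<_) i≡0 a<i)
  side-uncrossed {b = b} (inj₂ (_ , j+1≡n)) (inj₂ (_ , _ , j<b)) =
    ℕₚ.<⇒≱ (toℕ<n b) (subst (ℕ._≤ toℕ b) j+1≡n j<b)

  edge-crossed⇒diagonal : ∀ {n} {D : DSet n} {a b i j : Fin n} → Edge D i j → Cross a b i j → D ∋ i , j
  edge-crossed⇒diagonal (inj₁ side) cr = ⊥-elim (side-uncrossed side cr)
  edge-crossed⇒diagonal (inj₂ m) _ = m

  closing-side : ∀ {n} → Fin n →
    Σ (Fin n) λ first → Σ (Fin n) λ last → PolygonSide n first last × (∀ (v : Fin n) → first ≤ v × v ≤ last)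
  closing-side {suc m} _ = Fin.zero , fromℕ m , inj₂ (refl , cong suc (toℕ-fromℕ m)) , λ v → z≤n , ≤fromℕ v

  module Triangulation {n : ℕ} (D : DSet n) (T : IsTriangulation n D) where

    diagonal : ∀ {i j} → D ∋ i , j → Diagonal n i j
    diagonal {i} {j} = proj₁ T i j

    noncrossing : ∀ {i j k l} → D ∋ i , j → D ∋ k , l → ¬ Cross i j k l
    noncrossing {i} {j} {k} {l} = proj₁ (proj₂ T) i j k l

    maximal : ∀ {i j} → Diagonal n i j → ¬ D ∋ i , j →
              Σ (Fin n) λ k → Σ (Fin n) λ l → D ∋ k , l × Cross i j k l
    maximal {i} {j} = proj₂ (proj₂ T) i j

    edge-uncrossed : ∀ {i j k l} → Edge D i j → D ∋ k , l → ¬ Cross i j k l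
    edge-uncrossed e kl cr = noncrossing (edge-crossed⇒diagonal {D = D} e (cross-sym cr)) kl cr

    missing-not-edge : ∀ {p q} → Diagonal n p q → ¬ D ∋ p , q → ¬ Edge D p q
    missing-not-edge dg _ (inj₁ side) = diagonal-not-side dg side
    missing-not-edge _ ¬pq (inj₂ pq) = ¬pq pq

    uncrossed⇒edge : ∀ {i j} → i < j → (∀ {k l} → D ∋ k , l → ¬ Cross i j k l) → Edge D i j
    uncrossed⇒edge {i} {j} i<j uncrossed with side? i j | member? D i j
    ... | yes side | _ = inj₁ side
    ... | no _ | yes m = inj₂ m
    ... | no not-side | no ¬m
      with maximal (suc<⇒gap (ℕₚ.≤∧≢⇒< i<j (λ e → not-side (inj₁ e))) , λ e → not-side (inj₂ e)) ¬m
    ...   | _ , _ , kl , cr = ⊥-elim (uncrossed kl cr)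

    record Triangle (x w y : Fin n) : Set where
      constructor triangle
      field
        base  : Edge D x y
        left  : Edge D x w
        right : Edge D w y
        x<w   : x < w
        w<y   : w < y

    -- Every edge with a vertex strictly between its endpoints is the base of a
    -- triangle of D: its apex is the largest such w with (x,w) an edge.
    apex : ∀ {x y} → Edge D x y → suc (toℕ x) ℕ.< toℕ y → Σ (Fin n) λ w → Triangle x w y
    apex {x} {y} xy gap = build (greatest Below below? next-below)
      where
      Below : Fin n → Set
      Below w = x < w × w < y × Edge D x w

      below? : ∀ w → Dec (Below w)
      below? w = (toℕ x ℕₚ.<? toℕ w) ×-dec (toℕ w ℕₚ.<? toℕ y) ×-dec edge? D x w

      next<n : suc (toℕ x) ℕ.< n
      next<n = ℕₚ.<-trans gap (toℕ<n y)

      next-below : Below (fromℕ< next<n)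
      next-below rewrite toℕ-fromℕ< next<n = ℕₚ.n<1+n _ , gap , inj₁ (inj₁ refl)

      build : (Σ (Fin n) λ w → Below w × (∀ v → Below v → v ≤ w)) → Σ (Fin n) λ w → Triangle x w y
      build (w , (x<w , w<y , xw) , furthest) = w , triangle xy xw (uncrossed⇒edge w<y wy-uncrossed) x<w w<y
        where
        wy-uncrossed : ∀ {k l} → D ∋ k , l → ¬ Cross w y k l
        wy-uncrossed kl (inj₁ (w<k , k<y , y<l)) = edge-uncrossed xy kl (inj₁ (ℕₚ.<-trans x<w w<k , k<y , y<l))
        wy-uncrossed {k} {l} kl (inj₂ (k<w , w<l , l<y)) with <-cmp k x
        ... | tri< k<x _ _ = edge-uncrossed xy kl (inj₂ (k<x , ℕₚ.<-trans x<w w<l , l<y))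
        ... | tri≈ _ refl _ = ℕₚ.<⇒≱ w<l (furthest l (ℕₚ.<-trans x<w w<l , l<y , inj₂ kl))
        ... | tri> _ _ x<k = edge-uncrossed xw kl (inj₁ (x<k , k<w , w<l))

    open Triangle

    -- Every vertex p strictly inside an edge (x,y) is the apex of a triangle of
    -- D nested in (x,y): descend through the triangles below (x,y).
    apex-at : ∀ f {x y p} → Span f x y → Edge D x y → x < p → p < y →
              Σ (Fin n) λ a → Σ (Fin n) λ b → x ≤ a × b ≤ y × Triangle a p b
    apex-at ℕ.zero span _ x<p p<y = ⊥-elim (span-empty (ℕₚ.<-trans x<p p<y) span)
    apex-at (suc f) {x} {y} {p} span xy x<p p<y with apex xy (between-gap x<p p<y)
    ... | w , t with <-cmp p w
    ...   | tri≈ _ refl _ = x , y , ℕₚ.≤-refl , ℕₚ.≤-refl , t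
    ...   | tri< p<w _ _ with apex-at f (span-left (w<y t) span) (left t) x<p p<w
    ...     | a , b , x≤a , b≤w , t′ = a , b , x≤a , ℕₚ.≤-trans b≤w (ℕₚ.<⇒≤ (w<y t)) , t′
    apex-at (suc f) {x} {y} {p} span xy x<p p<y | w , t | tri> _ _ w<p
      with apex-at f (span-right (x<w t) span) (right t) w<p p<y
    ... | a , b , w≤a , b≤y , t′ = a , b , ℕₚ.≤-trans (ℕₚ.<⇒≤ (x<w t)) w≤a , b≤y , t′

    data Position (p q x w y : Fin n) : Set where
      through    : p < w → w < q → Position p q x w y
      left-side  : (p , q) ≡ (x , w) → Position p q x w y
      right-side : (p , q) ≡ (w , y) → Position p q x w y

    record Enclosure (p q : Fin n) : Set where
      constructor enclosure
      field
        x w y    : Fin n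
        tri      : Triangle x w y
        x≤p      : x ≤ p
        q≤y      : q ≤ y
        not-base : (p , q) ≢ (x , y)
        position : Position p q x w y

    -- Descend from an edge (x,y) enclosing (p,q) through the triangles below it
    -- until the chord passes through an apex or is a lower side.
    locate : ∀ f {x y p q} → Span f x y → Edge D x y → x ≤ p → p < q → q ≤ y →
             (p , q) ≢ (x , y) → Enclosure p q
    locate ℕ.zero span _ x≤p p<q q≤y _ = ⊥-elim (span-empty (ℕₚ.≤-<-trans x≤p (ℕₚ.<-≤-trans p<q q≤y)) span)
    locate (suc f) {x} {y} {p} {q} span xy x≤p p<q q≤y not-base with apex xy (nested-gap x≤p p<q q≤y not-base)
    ... | w , t with around p q w
    ...   | inside p<w w<q = enclosure x w y t x≤p q≤y not-base (through p<w w<q)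
    ...   | at-or-above q≤w with (p , q) ≟ₚ (x , w)
    ...     | yes on-left = enclosure x w y t x≤p q≤y not-base (left-side on-left)
    ...     | no not-left = locate f (span-left (w<y t) span) (left t) x≤p p<q q≤w not-left
    locate (suc f) {x} {y} {p} {q} span xy x≤p p<q q≤y not-base | w , t | at-or-below w≤p
      with (p , q) ≟ₚ (w , y)
    ... | yes on-right = enclosure x w y t x≤p q≤y not-base (right-side on-right)
    ... | no not-right = locate f (span-right (x<w t) span) (right t) w≤p p<q q≤y not-right

    enclose : ∀ {p q} → p < q → ¬ PolygonSide n p q → Enclosure p q
    enclose {p} {q} p<q not-side with closing-side p
    ... | first , last , side , bounds =
      locate n (span-full first last) (inj₁ side) (proj₁ (bounds p)) p<q (proj₂ (bounds q)) λ { refl → not-side side }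

    through-apex : ∀ {p q} → p < q → ¬ Edge D p q →
      Σ (Fin n) λ x → Σ (Fin n) λ w → Σ (Fin n) λ y → Triangle x w y × x ≤ p × p < w × w < q × q ≤ y
    through-apex p<q not-edge with enclose p<q (λ side → not-edge (inj₁ side))
    ... | enclosure x w y t x≤p q≤y _ (through p<w w<q) = x , w , y , t , x≤p , p<w , w<q , q≤y
    ... | enclosure x w y t _ _ _ (left-side refl) = ⊥-elim (not-edge (left t))
    ... | enclosure x w y t _ _ _ (right-side refl) = ⊥-elim (not-edge (right t))

    triangle-above : ∀ {u v} → D ∋ u , v →
      Σ (Fin n) λ x → Σ (Fin n) λ w → Σ (Fin n) λ y → Triangle x w y × ((u , v) ≡ (x , w) ⊎ (u , v) ≡ (w , y))
    triangle-above {u} {v} uv with enclose (diagonal⇒< (diagonal uv)) (diagonal-not-side (diagonal uv))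
    ... | enclosure x w y t _ _ _ (left-side e) = x , w , y , t , inj₁ e
    ... | enclosure x w y t _ _ _ (right-side e) = x , w , y , t , inj₂ e
    ... | enclosure x w y t x≤u v≤y not-base (through u<w w<v) with x ≟ u
    ...   | no x≢u = ⊥-elim (edge-uncrossed (left t) uv (inj₁ (≤∧≢⇒< x≤u x≢u , u<w , w<v)))
    ...   | yes refl =
      ⊥-elim (edge-uncrossed (right t) uv (inj₂ (u<w , w<v , ≤∧≢⇒< v≤y λ v≡y → not-base (cong (x ,_) v≡y))))

    FlipPartner : Fin n → Fin n → Fin n → Fin n → Set
    FlipPartner u v p q = Cross u v p q × (∀ {r s} → D ∋ r , s → (r , s) ≢ (u , v) → ¬ Cross r s p q)

    partner-avoids : ∀ {u v p q r s} → FlipPartner u v p q → Edge D r s → (r , s) ≢ (u , v) → ¬ Cross r s p q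
    partner-avoids {r = r} {s} (_ , only) rs rs≢uv cr = only (edge-crossed⇒diagonal {D = D} rs (cross-sym cr)) rs≢uv cr

    partner-under-right : ∀ {u v w y a b} → Triangle u w v → Triangle u v y →
                          FlipPartner u v a b → (a , b) ≡ (w , y)
    partner-under-right {u} {v} {w} {y} {a} {b} below above fp = from-crossing (proj₁ fp)
      where
      uw≢uv : (u , w) ≢ (u , v)
      uw≢uv = pair≢ʳ (<⇒≢ (w<y below))
      wv≢uv : (w , v) ≢ (u , v)
      wv≢uv = pair≢ˡ (≢-sym (<⇒≢ (x<w below)))
      vy≢uv : (v , y) ≢ (u , v)
      vy≢uv = pair≢ˡ (≢-sym (<⇒≢ (ℕₚ.<-trans (x<w below) (w<y below))))
      uy≢uv : (u , y) ≢ (u , v)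
      uy≢uv = pair≢ʳ (≢-sym (<⇒≢ (w<y above)))

      from-crossing : Cross u v a b → (a , b) ≡ (w , y)
      from-crossing (inj₁ (u<a , a<v , v<b)) = cong₂ _,_
        (pin (λ a<w → partner-avoids fp (left below) uw≢uv (inj₁ (u<a , a<w , ℕₚ.<-trans (w<y below) v<b)))
             (λ w<a → partner-avoids fp (right below) wv≢uv (inj₁ (w<a , a<v , v<b))))
        (pin (λ b<y → partner-avoids fp (right above) vy≢uv (inj₂ (a<v , v<b , b<y)))
             (λ y<b → partner-avoids fp (base above) uy≢uv (inj₁ (u<a , ℕₚ.<-trans a<v (w<y above) , y<b))))
      from-crossing (inj₂ (a<u , u<b , b<v)) =
        ⊥-elim (partner-avoids fp (base above) uy≢uv (inj₂ (a<u , u<b , ℕₚ.<-trans b<v (w<y above))))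

    partner-under-left : ∀ {u v w x a b} → Triangle u w v → Triangle x u v →
                         FlipPartner u v a b → (a , b) ≡ (x , w)
    partner-under-left {u} {v} {w} {x} {a} {b} below above fp = from-crossing (proj₁ fp)
      where
      uw≢uv : (u , w) ≢ (u , v)
      uw≢uv = pair≢ʳ (<⇒≢ (w<y below))
      wv≢uv : (w , v) ≢ (u , v)
      wv≢uv = pair≢ˡ (≢-sym (<⇒≢ (x<w below)))
      xu≢uv : (x , u) ≢ (u , v)
      xu≢uv = pair≢ʳ (<⇒≢ (ℕₚ.<-trans (x<w below) (w<y below)))
      xv≢uv : (x , v) ≢ (u , v)
      xv≢uv = pair≢ˡ (<⇒≢ (x<w above))

      from-crossing : Cross u v a b → (a , b) ≡ (x , w)
      from-crossing (inj₂ (a<u , u<b , b<v)) = cong₂ _,_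
        (pin (λ a<x → partner-avoids fp (base above) xv≢uv (inj₂ (a<x , ℕₚ.<-trans (x<w above) u<b , b<v)))
             (λ x<a → partner-avoids fp (left above) xu≢uv (inj₁ (x<a , a<u , u<b))))
        (pin (λ b<w → partner-avoids fp (left below) uw≢uv (inj₂ (a<u , u<b , b<w)))
             (λ w<b → partner-avoids fp (right below) wv≢uv (inj₂ (ℕₚ.<-trans a<u (x<w below) , w<b , b<v))))
      from-crossing (inj₁ (u<a , a<v , v<b)) =
        ⊥-elim (partner-avoids fp (base above) xv≢uv (inj₁ (ℕₚ.<-trans (x<w above) u<a , a<v , v<b)))

    partner-unique : ∀ {u v p q k l} → D ∋ u , v → FlipPartner u v p q → FlipPartner u v k l → (p , q) ≡ (k , l)
    partner-unique uv fp fk with apex (inj₂ uv) (gap⇒suc< (proj₁ (diagonal uv))) | triangle-above uv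
    ... | _ , below | _ , _ , _ , above , inj₁ refl = trans (partner-under-right below above fp) (sym (partner-under-right below above fk))
    ... | _ , below | _ , _ , _ , above , inj₂ refl = trans (partner-under-left below above fp) (sym (partner-under-left below above fk))

    -- If (k,l) is a flip partner of (i,j) ∈ D with i < k < j < l, the four sides
    -- of the quadrilateral i,k,j,l are edges of D: no diagonal of D can cross them.
    quadrilateral : ∀ {i j k l} → D ∋ i , j → FlipPartner i j k l → i < k → k < j → j < l →
                    Edge D i k × Edge D k j × Edge D j l × Edge D i l
    quadrilateral {i} {j} {k} {l} ij fp i<k k<j j<l = ik , kj , jl , il
      where
      misses-ij : ∀ {r s} → D ∋ r , s → ¬ Cross i j r s
      misses-ij rs = noncrossing ij rs

      misses-kl : ∀ {r s} → D ∋ r , s → (r , s) ≢ (i , j) → ¬ Cross k l r s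
      misses-kl rs rs≢ij cr = proj₂ fp rs rs≢ij (cross-sym cr)

      ik-uncrossed : ∀ {r s} → D ∋ r , s → ¬ Cross i k r s
      ik-uncrossed {r} {s} rs (inj₁ (i<r , r<k , k<s)) with toℕ s ℕₚ.<? toℕ l
      ... | yes s<l = misses-kl rs (pair≢ˡ (≢-sym (<⇒≢ i<r))) (inj₂ (r<k , k<s , s<l))
      ... | no s≮l = misses-ij rs (inj₁ (i<r , ℕₚ.<-trans r<k k<j , ℕₚ.<-≤-trans j<l (ℕₚ.≮⇒≥ s≮l)))
      ik-uncrossed rs (inj₂ (r<i , i<s , s<k)) = misses-ij rs (inj₂ (r<i , i<s , ℕₚ.<-trans s<k k<j))

      kj-uncrossed : ∀ {r s} → D ∋ r , s → ¬ Cross k j r s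
      kj-uncrossed rs (inj₁ (k<r , r<j , j<s)) = misses-ij rs (inj₁ (ℕₚ.<-trans i<k k<r , r<j , j<s))
      kj-uncrossed rs (inj₂ (r<k , k<s , s<j)) = misses-kl rs (pair≢ʳ (<⇒≢ s<j)) (inj₂ (r<k , k<s , ℕₚ.<-trans s<j j<l))

      jl-uncrossed : ∀ {r s} → D ∋ r , s → ¬ Cross j l r s
      jl-uncrossed rs (inj₁ (j<r , r<l , l<s)) =
        misses-kl rs (pair≢ˡ (≢-sym (<⇒≢ (ℕₚ.<-trans (ℕₚ.<-trans i<k k<j) j<r)))) (inj₁ (ℕₚ.<-trans k<j j<r , r<l , l<s))
      jl-uncrossed {r} {s} rs (inj₂ (r<j , j<s , s<l)) with toℕ r ℕₚ.<? toℕ k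
      ... | yes r<k = misses-kl rs (pair≢ʳ (≢-sym (<⇒≢ j<s))) (inj₂ (r<k , ℕₚ.<-trans k<j j<s , s<l))
      ... | no r≮k = misses-ij rs (inj₁ (ℕₚ.<-≤-trans i<k (ℕₚ.≮⇒≥ r≮k) , r<j , j<s))

      il-uncrossed : ∀ {r s} → D ∋ r , s → ¬ Cross i l r s
      il-uncrossed {r} {s} rs (inj₁ (i<r , r<l , l<s)) with toℕ r ℕₚ.<? toℕ j
      ... | yes r<j = misses-ij rs (inj₁ (i<r , r<j , ℕₚ.<-trans j<l l<s))
      ... | no r≮j = misses-kl rs (pair≢ˡ (≢-sym (<⇒≢ i<r))) (inj₁ (ℕₚ.<-≤-trans k<j (ℕₚ.≮⇒≥ r≮j) , r<l , l<s))
      il-uncrossed {r} {s} rs (inj₂ (r<i , i<s , s<l)) with toℕ s ℕₚ.<? toℕ j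
      ... | yes s<j = misses-ij rs (inj₂ (r<i , i<s , s<j))
      ... | no s≮j = misses-kl rs (pair≢ˡ (<⇒≢ r<i)) (inj₂ (ℕₚ.<-trans r<i i<k , ℕₚ.<-≤-trans k<j (ℕₚ.≮⇒≥ s≮j) , s<l))

      ik : Edge D i k
      ik = uncrossed⇒edge i<k ik-uncrossed

      kj : Edge D k j
      kj = uncrossed⇒edge k<j kj-uncrossed

      jl : Edge D j l
      jl = uncrossed⇒edge j<l jl-uncrossed

      il : Edge D i l
      il = uncrossed⇒edge (ℕₚ.<-trans i<k (ℕₚ.<-trans k<j j<l)) il-uncrossed

  -- D' arises from D by removing the diagonal (i,j) and inserting (k,l);
  -- `Flip n D D'` is exactly `Σ i j k l, IsFlip D D' i j k l`.
  IsFlip : ∀ {n} → DSet n → DSet n → Fin n → Fin n → Fin n → Fin n → Set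
  IsFlip D D' i j k l =
    (D ∋ i , j) × ¬ (D ∋ k , l) ×
    (∀ p q → (D' ∋ p , q) ⇔ (((D ∋ p , q) × ¬ ((p , q) ≡ (i , j))) ⊎ ((p , q) ≡ (k , l))))

  module Flipped {n} {D D' : DSet n} {i j k l : Fin n} (flip : IsFlip D D' i j k l) where

    removed : D ∋ i , j
    removed = proj₁ flip

    absent : ¬ D ∋ k , l
    absent = proj₁ (proj₂ flip)

    private
      change : ∀ p q → (D' ∋ p , q) ⇔ (((D ∋ p , q) × ¬ ((p , q) ≡ (i , j))) ⊎ ((p , q) ≡ (k , l)))
      change = proj₂ (proj₂ flip)

    inserted : D' ∋ k , l
    inserted = Equivalence.from (change k l) (inj₂ refl)

    kept : ∀ {p q} → D ∋ p , q → (p , q) ≢ (i , j) → D' ∋ p , q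
    kept {p} {q} pq ne = Equivalence.from (change p q) (inj₁ (pq , ne))

    new-only-inserted : ∀ {p q} → D' ∋ p , q → (p , q) ≢ (k , l) → D ∋ p , q
    new-only-inserted {p} {q} pq′ ne with Equivalence.to (change p q) pq′
    ... | inj₁ (pq , _) = pq
    ... | inj₂ e = ⊥-elim (ne e)

    gone : ¬ D' ∋ i , j
    gone ij′ with Equivalence.to (change i j) ij′
    ... | inj₁ (_ , ne) = ne refl
    ... | inj₂ e = absent (∋-pair {D = D} e removed)

    unchanged : ∀ {p q} → (p , q) ≢ (i , j) → (p , q) ≢ (k , l) →
                lookup (lookup D p) q ≡ lookup (lookup D' p) q
    unchanged ne-ij ne-kl = Boolₚ.⇔→≡ (mk⇔ (λ pq → kept pq ne-ij) (λ pq′ → new-only-inserted pq′ ne-kl))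

  flip-symmetric : ∀ {n} {D D' : DSet n} {i j k l} → IsFlip D D' i j k l → IsFlip D' D k l i j
  flip-symmetric {D = D} {D'} {i} {j} {k} {l} flip = inserted , gone , λ p q → mk⇔ (to p q) (from p q)
    where
    open Flipped {D = D} {D'} flip

    to : ∀ p q → D ∋ p , q → ((D' ∋ p , q) × ¬ ((p , q) ≡ (k , l))) ⊎ ((p , q) ≡ (i , j))
    to p q pq with (p , q) ≟ₚ (i , j)
    ... | yes e = inj₂ e
    ... | no ne = inj₁ (kept pq ne , λ e → absent (∋-pair {D = D} e pq))

    from : ∀ p q → ((D' ∋ p , q) × ¬ ((p , q) ≡ (k , l))) ⊎ ((p , q) ≡ (i , j)) → D ∋ p , q
    from p q (inj₁ (pq′ , ne)) = new-only-inserted pq′ ne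
    from p q (inj₂ refl) = removed

  flip-partner : ∀ {n} {D D' : DSet n} (T : IsTriangulation n D) (T' : IsTriangulation n D') →
                 ∀ {i j k l} → IsFlip D D' i j k l → Triangulation.FlipPartner D T i j k l
  flip-partner {D = D} {D'} T T' {i} {j} {k} {l} flip = crosses , only
    where
    open Flipped {D = D} {D'} flip
    module 𝒯 = Triangulation D T
    module 𝒯′ = Triangulation D' T'

    only : ∀ {r s} → D ∋ r , s → (r , s) ≢ (i , j) → ¬ Cross r s k l
    only rs ne = 𝒯′.noncrossing (kept rs ne) inserted

    crosses : Cross i j k l
    crosses with 𝒯.maximal (𝒯′.diagonal inserted) absent
    ... | r , s , rs , cr with (r , s) ≟ₚ (i , j)
    ...   | yes refl = cross-sym cr
    ...   | no ne = ⊥-elim (only rs ne (cross-sym cr))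

  0ᵥ : V
  0ᵥ = Fin.zero

  NonzeroEnds : ∀ {n} → (Fin n → V) → Fin n → Fin n → Set
  NonzeroEnds c p q = c p ≢ 0ᵥ × c q ≢ 0ᵥ

  ZeroEnd : ∀ {n} → (Fin n → V) → Fin n → Fin n → Set
  ZeroEnd c p q = c p ≡ 0ᵥ ⊎ c q ≡ 0ᵥ

  ends? : ∀ {n} (c : Fin n → V) p q → NonzeroEnds c p q ⊎ ZeroEnd c p q
  ends? c p q with c p ≟ 0ᵥ | c q ≟ 0ᵥ
  ... | yes z | _ = inj₂ (inj₁ z)
  ... | no _ | yes z = inj₂ (inj₂ z)
  ... | no p≢0 | no q≢0 = inj₁ (p≢0 , q≢0)

  isNonzero : V → Bool
  isNonzero Fin.zero    = false
  isNonzero (Fin.suc _) = true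

  avoidsZero : V → V → Bool
  avoidsZero a b = isNonzero a ∧ isNonzero b

  avoidsZero-nonzero : ∀ {a b} → a ≢ 0ᵥ → b ≢ 0ᵥ → avoidsZero a b ≡ true
  avoidsZero-nonzero {Fin.zero} a≢0 _ = ⊥-elim (a≢0 refl)
  avoidsZero-nonzero {Fin.suc _} {Fin.zero} _ b≢0 = ⊥-elim (b≢0 refl)
  avoidsZero-nonzero {Fin.suc _} {Fin.suc _} _ _ = refl

  avoidsZero-zero : ∀ {a b} → a ≡ 0ᵥ ⊎ b ≡ 0ᵥ → avoidsZero a b ≡ false
  avoidsZero-zero (inj₁ refl) = refl
  avoidsZero-zero {a} (inj₂ refl) = Boolₚ.∧-zeroʳ (isNonzero a)

  Distinct4 : V → V → V → V → Set
  Distinct4 a b c d = a ≢ b × a ≢ c × a ≢ d × b ≢ c × b ≢ d × c ≢ d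

  -- Four pairwise distinct elements of the four-element group V contain 0
  -- exactly once, so exactly one of the pairs {a,b}, {c,d} avoids 0.
  -- Checked by enumerating V⁴.
  one-pair-avoids-zero : ∀ a b c d → Distinct4 a b c d → avoidsZero a b ≢ avoidsZero c d
  one-pair-avoids-zero = toWitness {a? = all? λ a → all? λ b → all? λ c → all? λ d →
    (¬? (a ≟ b) ×-dec ¬? (a ≟ c) ×-dec ¬? (a ≟ d) ×-dec ¬? (b ≟ c) ×-dec ¬? (b ≟ d) ×-dec ¬? (c ≟ d))
      →-dec ¬? (avoidsZero a b Boolₚ.≟ avoidsZero c d)} _

  module ColouredPolygon {n} (c : Fin n → V) (pc : ProperColoring n c) where

    module _ {D : DSet n} (T : IsTriangulation n D) (cm : Compatible n c D) where
      open Triangulation D T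

      edge-colours : ∀ {i j} → Edge D i j → c i ≢ c j
      edge-colours {i} {j} (inj₁ (inj₁ consecutive)) = proj₁ pc i j consecutive
      edge-colours {i} {j} (inj₁ (inj₂ (i≡0 , j+1≡n))) = proj₂ pc i j i≡0 j+1≡n
      edge-colours {i} {j} (inj₂ m) = cm i j m

      beside-zeroʳ : ∀ {i j} → Edge D i j → c i ≡ 0ᵥ → c j ≢ 0ᵥ
      beside-zeroʳ e ci≡0 cj≡0 = edge-colours e (trans ci≡0 (sym cj≡0))

      beside-zeroˡ : ∀ {i j} → Edge D i j → c j ≡ 0ᵥ → c i ≢ 0ᵥ
      beside-zeroˡ e cj≡0 ci≡0 = edge-colours e (trans ci≡0 (sym cj≡0))

      NonzeroCrossing : Fin n → Fin n → Set
      NonzeroCrossing p q = Σ (Fin n) λ r → Σ (Fin n) λ s → D ∋ r , s × NonzeroEnds c r s × Cross p q r s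

      -- A diagonal with a 0-coloured endpoint that is missing from D is crossed by
      -- a diagonal of D with nonzero endpoints: the triangle of D through whose
      -- apex it passes provides one, next to its 0-coloured endpoint.
      nonzero-crossing : ∀ {p q} → Diagonal n p q → ¬ D ∋ p , q → ZeroEnd c p q → NonzeroCrossing p q
      nonzero-crossing {p} {q} dg ¬pq z with through-apex (diagonal⇒< dg) (missing-not-edge dg ¬pq)
      ... | x , w , y , t , x≤p , p<w , w<q , q≤y = from-zero z
        where
        open Triangle

        witness : ∀ {a b} → Edge D a b → Cross p q a b → c a ≢ 0ᵥ → c b ≢ 0ᵥ → NonzeroCrossing p q
        witness {a} {b} ab cr a≢0 b≢0 = a , b , edge-crossed⇒diagonal {D = D} ab cr , (a≢0 , b≢0) , cr

        from-zero : ZeroEnd c p q → NonzeroCrossing p q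
        from-zero (inj₁ p≡0) with x ≟ p
        ... | no x≢p with apex-at n (span-full x w) (left t) (≤∧≢⇒< x≤p x≢p) p<w
        ...   | a , b , _ , b≤w , t′ =
                witness (base t′) (inj₂ (x<w t′ , w<y t′ , ℕₚ.≤-<-trans b≤w w<q))
                        (beside-zeroˡ (left t′) p≡0) (beside-zeroʳ (right t′) p≡0)
        from-zero (inj₁ p≡0) | yes refl with q ≟ y
        ... | yes refl = ⊥-elim (missing-not-edge dg ¬pq (base t))
        ... | no q≢y = witness (right t) (inj₁ (p<w , w<q , ≤∧≢⇒< q≤y q≢y))
                               (beside-zeroʳ (left t) p≡0) (beside-zeroʳ (base t) p≡0)
        from-zero (inj₂ q≡0) with q ≟ y
        ... | no q≢y with apex-at n (span-full w y) (right t) w<q (≤∧≢⇒< q≤y q≢y)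
        ...   | a , b , w≤a , _ , t′ =
                witness (base t′) (inj₁ (ℕₚ.<-≤-trans p<w w≤a , x<w t′ , w<y t′))
                        (beside-zeroˡ (left t′) q≡0) (beside-zeroʳ (right t′) q≡0)
        from-zero (inj₂ q≡0) | yes refl with x ≟ p
        ... | yes refl = ⊥-elim (missing-not-edge dg ¬pq (base t))
        ... | no x≢p = witness (left t) (inj₂ (≤∧≢⇒< x≤p x≢p , p<w , w<q))
                               (beside-zeroˡ (base t) q≡0) (beside-zeroˡ (right t) q≡0)

      zero-end-forced : ∀ {p q} → Diagonal n p q → ZeroEnd c p q →
                        (∀ {r s} → D ∋ r , s → NonzeroEnds c r s → ¬ Cross p q r s) → D ∋ p , q
      zero-end-forced {p} {q} dg z free with member? D p q
      ... | yes pq = pq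
      ... | no ¬pq with nonzero-crossing dg ¬pq z
      ...   | _ , _ , rs , nz , cr = ⊥-elim (free rs nz cr)

    zero-ends-follow : ∀ {D D'} → IsTriangulation n D → IsTriangulation n D' → Compatible n c D' →
                       (∀ {r s} → D' ∋ r , s → NonzeroEnds c r s → D ∋ r , s) →
                       ∀ {p q} → D ∋ p , q → ZeroEnd c p q → D' ∋ p , q
    zero-ends-follow {D} {D'} T T' cm' nonzero⊆ pq z =
      zero-end-forced {D'} T' cm' (𝒯.diagonal pq) z λ rs′ nz → 𝒯.noncrossing pq (nonzero⊆ rs′ nz)
      where module 𝒯 = Triangulation D T

    -- The four corners of a flipped quadrilateral carry four distinct colours:
    -- its sides are edges of D or of D', and its diagonals are compatible.
    flip-colours : ∀ {D D'} → (T : IsTriangulation n D) (T' : IsTriangulation n D') →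
                   Compatible n c D → Compatible n c D' →
                   ∀ {i j k l} → IsFlip D D' i j k l → Distinct4 (c i) (c j) (c k) (c l)
    flip-colours {D} {D'} T T' cm cm' {i} {j} {k} {l} flip = from-crossing (proj₁ partner)
      where
      open Flipped {D = D} {D'} flip

      partner : Triangulation.FlipPartner D T i j k l
      partner = flip-partner {D = D} {D'} T T' flip

      from-crossing : Cross i j k l → Distinct4 (c i) (c j) (c k) (c l)
      from-crossing (inj₁ (i<k , k<j , j<l)) with Triangulation.quadrilateral D T removed partner i<k k<j j<l
      ... | ik , kj , jl , il =
        cm _ _ removed , edge-colours {D} T cm ik , edge-colours {D} T cm il ,
        ≢-sym (edge-colours {D} T cm kj) , edge-colours {D} T cm jl , cm' _ _ inserted
      from-crossing (inj₂ (k<i , i<l , l<j))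
        with Triangulation.quadrilateral D' T' inserted partner′ k<i i<l l<j
        where
        partner′ : Triangulation.FlipPartner D' T' k l i j
        partner′ = flip-partner {D = D'} {D} T' T (flip-symmetric {D = D} {D'} flip)
      ... | ki , il , lj , kj =
        cm _ _ removed , ≢-sym (edge-colours {D'} T' cm' ki) , edge-colours {D'} T' cm' il ,
        ≢-sym (edge-colours {D'} T' cm' kj) , ≢-sym (edge-colours {D'} T' cm' lj) , cm' _ _ inserted

    code : DSet n → Fin n → Fin n → Bool
    code D p q = lookup (lookup D p) q ∧ avoidsZero (c p) (c q)

    code-nonzero : ∀ D {p q} → NonzeroEnds c p q → code D p q ≡ lookup (lookup D p) q
    code-nonzero D {p} {q} (p≢0 , q≢0) rewrite avoidsZero-nonzero p≢0 q≢0 = Boolₚ.∧-identityʳ _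

    code-zero : ∀ D {p q} → ZeroEnd c p q → code D p q ≡ false
    code-zero D {p} {q} z rewrite avoidsZero-zero z = Boolₚ.∧-zeroʳ _

    code-member : ∀ {D p q} → D ∋ p , q → code D p q ≡ avoidsZero (c p) (c q)
    code-member pq rewrite pq = refl

    code-absent : ∀ {D p q} → ¬ D ∋ p , q → code D p q ≡ false
    code-absent {D} {p} {q} ¬pq with lookup (lookup D p) q
    ... | true = ⊥-elim (¬pq refl)
    ... | false = refl

    same-code-transfers : ∀ D D' {p q} → code D p q ≡ code D' p q → NonzeroEnds c p q → D ∋ p , q → D' ∋ p , q
    same-code-transfers D D' same nz pq =
      trans (sym (code-nonzero D' nz)) (trans (sym same) (trans (code-nonzero D nz) pq))

    -- Injectivity: compatible triangulations with the same code are equal, since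
    -- the diagonals with a 0-coloured endpoint are forced by the others.
    code-injective : ∀ {D D'} → IsTriangulation n D → IsTriangulation n D' →
                     Compatible n c D → Compatible n c D' →
                     (∀ p q → code D p q ≡ code D' p q) → D ≡ D'
    code-injective {D} {D'} T T' cm cm' same =
      matrix-ext λ p q → Boolₚ.⇔→≡ (mk⇔ (included {D} {D'} T T' cm' same)
                                        (included {D'} {D} T' T cm λ p q → sym (same p q)))
      where
      included : ∀ {A B} → IsTriangulation n A → IsTriangulation n B → Compatible n c B →
                 (∀ p q → code A p q ≡ code B p q) → ∀ {p q} → A ∋ p , q → B ∋ p , q
      included {A} {B} TA TB cmB same {p} {q} pq with ends? c p q
      ... | inj₁ nz = same-code-transfers A B (same p q) nz pq
      ... | inj₂ z = zero-ends-follow {A} {B} TA TB cmB nonzero-back pq z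
        where
        nonzero-back : ∀ {r s} → B ∋ r , s → NonzeroEnds c r s → A ∋ r , s
        nonzero-back {r} {s} rs nz = same-code-transfers B A (sym (same r s)) nz rs

    removal-changes-code : ∀ {D D' i j k l} → IsFlip D D' i j k l →
                           avoidsZero (c i) (c j) ≡ true → avoidsZero (c k) (c l) ≡ false →
                           DifferOnlyAt (code D) (code D') i j
    removal-changes-code {D} {D'} {i} {j} {k} {l} flip ij-nonzero kl-zero = differ , agree
      where
      open Flipped {D = D} {D'} flip

      differ : code D i j ≢ code D' i j
      differ e with trans (sym (trans (code-member {D} removed) ij-nonzero)) (trans e (code-absent {D'} gone))
      ... | ()

      agree : ∀ p q → (p , q) ≢ (i , j) → code D p q ≡ code D' p q
      agree p q ne-ij with (p , q) ≟ₚ (k , l)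
      ... | yes refl = trans (code-absent {D} absent) (sym (trans (code-member {D'} inserted) kl-zero))
      ... | no ne-kl = cong (_∧ avoidsZero (c p) (c q)) (unchanged ne-ij ne-kl)

    -- A flip between compatible triangulations changes the code at exactly one
    -- diagonal: of the removed and the inserted diagonal exactly one is nonzero.
    flip-changes-code-once : ∀ {D D'} → IsTriangulation n D → IsTriangulation n D' →
                             Compatible n c D → Compatible n c D' → Flip n D D' →
                             Σ (Fin n) λ u → Σ (Fin n) λ v → DifferOnlyAt (code D) (code D') u v
    flip-changes-code-once {D} {D'} T T' cm cm' (i , j , k , l , flip)
      with distinct-bools (one-pair-avoids-zero _ _ _ _ (flip-colours {D} {D'} T T' cm cm' flip))
    ... | inj₁ (ij-nonzero , kl-zero) = i , j , removal-changes-code {D} {D'} flip ij-nonzero kl-zero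
    ... | inj₂ (ij-zero , kl-nonzero) =
          k , l , differ-sym (removal-changes-code {D'} {D} (flip-symmetric {D = D} {D'} flip) kl-nonzero ij-zero)

    -- Conversely, suppose D and D' contain the same nonzero diagonals except
    -- (u,v), which lies in D only.  Every other diagonal of D survives in D'
    -- (the nonzero ones by assumption, the others because they are forced), and
    -- every new diagonal of D' crosses (u,v) and nothing else of D, hence is the
    -- unique flip partner (k,l) of (u,v).
    single-change-flip : ∀ {D D' u v} → IsTriangulation n D → IsTriangulation n D' →
      Compatible n c D → Compatible n c D' → D ∋ u , v → ¬ D' ∋ u , v →
      (∀ {p q} → (p , q) ≢ (u , v) → NonzeroEnds c p q → lookup (lookup D p) q ≡ lookup (lookup D' p) q) →
      Σ (Fin n) λ k → Σ (Fin n) λ l → IsFlip D D' u v k l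
    single-change-flip {D} {D'} {u} {v} T T' cm cm' uv ¬uv′ agree
      with Triangulation.maximal D' T' (Triangulation.diagonal D T uv) ¬uv′
    ... | k , l , kl′ , uv×kl = k , l , uv , ¬kl , λ p q → mk⇔ (to p q) (from p q)
      where
      module 𝒯 = Triangulation D T
      module 𝒯′ = Triangulation D' T'

      ¬kl : ¬ D ∋ k , l
      ¬kl kl = 𝒯.noncrossing uv kl uv×kl

      nonzero-back : ∀ {r s} → D' ∋ r , s → NonzeroEnds c r s → D ∋ r , s
      nonzero-back {r} {s} rs′ nz with (r , s) ≟ₚ (u , v)
      ... | yes refl = ⊥-elim (¬uv′ rs′)
      ... | no ne = trans (agree ne nz) rs′

      kept : ∀ {p q} → D ∋ p , q → (p , q) ≢ (u , v) → D' ∋ p , q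
      kept {p} {q} pq ne with ends? c p q
      ... | inj₁ nz = trans (sym (agree ne nz)) pq
      ... | inj₂ z = zero-ends-follow {D} {D'} T T' cm' nonzero-back pq z

      partner : ∀ {p q} → D' ∋ p , q → Cross u v p q → 𝒯.FlipPartner u v p q
      partner pq′ cr = cr , λ rs ne → 𝒯′.noncrossing (kept rs ne) pq′

      new-is-kl : ∀ {p q} → D' ∋ p , q → ¬ D ∋ p , q → (p , q) ≡ (k , l)
      new-is-kl {p} {q} pq′ ¬pq with ends? c p q
      ... | inj₁ nz = ⊥-elim (¬pq (nonzero-back pq′ nz))
      ... | inj₂ z with cross? u v p q
      ...   | yes cr = 𝒯.partner-unique uv (partner pq′ cr) (partner kl′ uv×kl)
      ...   | no ¬cr = ⊥-elim (¬pq (zero-end-forced {D} T cm (𝒯′.diagonal pq′) z free))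
        where
        free : ∀ {r s} → D ∋ r , s → NonzeroEnds c r s → ¬ Cross p q r s
        free {r} {s} rs _ with (r , s) ≟ₚ (u , v)
        ... | yes refl = λ cr → ¬cr (cross-sym cr)
        ... | no ne = 𝒯′.noncrossing pq′ (kept rs ne)

      to : ∀ p q → D' ∋ p , q → ((D ∋ p , q) × ¬ ((p , q) ≡ (u , v))) ⊎ ((p , q) ≡ (k , l))
      to p q pq′ with member? D p q
      ... | yes pq = inj₁ (pq , λ { refl → ¬uv′ pq′ })
      ... | no ¬pq = inj₂ (new-is-kl pq′ ¬pq)

      from : ∀ p q → ((D ∋ p , q) × ¬ ((p , q) ≡ (u , v))) ⊎ ((p , q) ≡ (k , l)) → D' ∋ p , q
      from p q (inj₁ (pq , ne)) = kept pq ne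
      from p q (inj₂ refl) = kl′

    code-drop-flip : ∀ {D D' u v} → IsTriangulation n D → IsTriangulation n D' →
                     Compatible n c D → Compatible n c D' →
                     DifferOnlyAt (code D) (code D') u v → code D u v ≡ true →
                     Σ (Fin n) λ k → Σ (Fin n) λ l → IsFlip D D' u v k l
    code-drop-flip {D} {D'} {u} {v} T T' cm cm' (differ , agree) coded with ends? c u v
    ... | inj₁ nz = single-change-flip {D} {D'} T T' cm cm' uv ¬uv′ agree′
      where
      uv : D ∋ u , v
      uv = trans (sym (code-nonzero D nz)) coded

      ¬uv′ : ¬ D' ∋ u , v
      ¬uv′ uv′ = differ (trans coded (sym (trans (code-nonzero D' nz) uv′)))

      agree′ : ∀ {p q} → (p , q) ≢ (u , v) → NonzeroEnds c p q →
               lookup (lookup D p) q ≡ lookup (lookup D' p) q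
      agree′ {p} {q} ne nz = trans (sym (code-nonzero D nz)) (trans (agree p q ne) (code-nonzero D' nz))
    ... | inj₂ z with trans (sym (code-zero D z)) coded
    ...   | ()

    code-change-flip : ∀ {D D' u v} → IsTriangulation n D → IsTriangulation n D' →
                       Compatible n c D → Compatible n c D' →
                       DifferOnlyAt (code D) (code D') u v → Flip n D D'
    code-change-flip {D} {D'} {u} {v} T T' cm cm' once with distinct-bools (proj₁ once)
    ... | inj₁ (in-D , _) = u , v , code-drop-flip {D} {D'} T T' cm cm' once in-D
    ... | inj₂ (_ , in-D') with code-drop-flip {D'} {D} T' T cm' cm (differ-sym once) in-D'
    ...   | k , l , flip = k , l , u , v , flip-symmetric {D = D'} {D} flip

open import Data.Nat using (_≤_)

theorem2 : (n : ℕ) → 3 ≤ n → (c : Fin n → V) → ProperColoring n c →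
    Σ ℕ λ m → Σ (ColorVertex n c → Subset m) λ f →
      (∀ T T' → f T ≡ f T' → proj₁ T ≡ proj₁ T') ×
      (∀ T T' → ColorAdj n c T T' ⇔ HypercubeAdj m (f T) (f T'))
theorem2 n _ c pc = n * n , encode , injective , adjacency
  where
  open ColouredPolygon c pc

  encode : ColorVertex n c → Subset (n * n)
  encode T = table (code (proj₁ T))

  injective : ∀ T T' → encode T ≡ encode T' → proj₁ T ≡ proj₁ T'
  injective (D , T , cm) (D' , T' , cm') same = code-injective {D} {D'} T T' cm cm' (table-injective same)

  adjacency : ∀ T T' → ColorAdj n c T T' ⇔ HypercubeAdj (n * n) (encode T) (encode T')
  adjacency (D , T , cm) (D' , T' , cm') = mk⇔
    (λ flip → from (flip-changes-code-once {D} {D'} T T' cm cm' flip))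
    (λ adjacent → let (_ , _ , once) = to adjacent in code-change-flip {D} {D'} T T' cm cm' once)
    where open Equivalence (adjacent⇔differ-once (code D) (code D'))
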